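{- Let $M$ be a finite left regular band with minimal ideal $\widehat 0$ and $P$ an adapted probability on $M$. Let $\tau$ be the absorption time into $\widehat 0$ of the right random walk on $M$ driven by $P$ started at $1$. Then $$E[\tau]=-\sum_{X>\widehat 0}\frac{1}{1-\lambda_X}\,\mu(\widehat 0,X),$$ the sum running over $X\in\Lambda(M)$, $X\neq\widehat 0$.
   Context: A left regular band is a monoid with $x^2=x$, $xyx=xy$. $\Lambda(M)=\{Me:e^2=e\}$ ordered by inclusion with least element $\widehat 0$ and Möbius function $\mu$. For $m\in M$, $c(m)=Mm$ (since $m$ is idempotent), and $\lambda_X=\sum_{m\in M,\ c(m)\ge X}P(m)$. $P$ is adapted if the submonoid generated by its support contains $\widehat 0$. The right random walk on $M$ driven by $P$ has state set $M$ and from state $m$ moves to $mx$ with probability $P(x)$ (summed over $x$); $\tau$ is the first time the walk, started at $1$, lies in $\widehat 0$.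
   Formalization: The adapted probability P on M takes rational values rather than real ones. -}

module Defs where

open import Data.Nat using (ℕ; zero; suc; _≥_)
open import Data.Fin using (Fin)
open import Data.Fin.Subset using (Subset; _⊆_)
open import Data.Fin.Subset.Properties using (_⊆?_)
import Data.Fin.Properties as FinP
open import Data.Bool using (Bool; true; false)
import Data.Bool.Properties as BoolP
open import Data.Vec using (tabulate)
open import Data.Vec.Properties using (≡-dec)
open import Data.List using (List; []; _∷_; map; foldr; filter; deduplicate; allFin; length)
open import Data.List.Relation.Unary.All using (All)
open import Data.Product using (Σ; ∃; _×_; _,_)
open import Relation.Binary.PropositionalEquality using (_≡_; _≢_)
open import Relation.Nullary using (Dec; yes; no; ¬_; ¬?; _×-dec_)
open import Relation.Nullary.Decidable using (⌊_⌋)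
import Data.Integer as ℤ
open import Data.Rational using (ℚ; _/_; 0ℚ; 1ℚ; _+_; _*_; _-_; -_; 1/_; _≤_; _<_; ∣_∣; ≢-nonZero)
import Data.Rational.Properties as ℚP

record FiniteLRB : Set where
  field
    n      : ℕ
    _·_    : Fin n → Fin n → Fin n
    one    : Fin n
    assoc  : ∀ x y z → (x · y) · z ≡ x · (y · z)
    idˡ    : ∀ x → one · x ≡ x
    idʳ    : ∀ x → x · one ≡ x
    idem   : ∀ x → x · x ≡ x
    lrb    : ∀ x y → (x · y) · x ≡ x · y

sumL : {A : Set} → (A → ℚ) → List A → ℚ
sumL f = foldr (λ a s → f a + s) 0ℚ

Σ[Fin] : (k : ℕ) → (Fin k → ℚ) → ℚ
Σ[Fin] k f = sumL f (allFin k)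

[_] : {A : Set} → Dec A → ℚ
[ yes _ ] = 1ℚ
[ no  _ ] = 0ℚ

-- reciprocal, with the (irrelevant) convention 1/0 := 0
inv : ℚ → ℚ
inv q with q ℚP.≟ 0ℚ
... | yes _ = 0ℚ
... | no q≢0 = 1/_ q {{≢-nonZero q≢0}}

module _ (M : FiniteLRB) where
  open FiniteLRB M

  c : Fin n → Subset n
  c m = tabulate (λ y → ⌊ FinP.any? (λ x → x · m FinP.≟ y) ⌋)

  -- Λ(M) = { M e : e² = e } (every element is idempotent), without repetition
  Λ : List (Subset n)
  Λ = deduplicate (≡-dec BoolP._≟_) (map c (allFin n))

  _⊊_ : Subset n → Subset n → Set
  X ⊊ Y = X ⊆ Y × X ≢ Y

  _⊊?_ : ∀ X Y → Dec (X ⊊ Y)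
  X ⊊? Y = (X ⊆? Y) ×-dec ¬? (≡-dec BoolP._≟_ X Y)

  -- The recursion is run with fuel; fuel = |Λ(M)| exceeds the length of
  -- every chain in Λ(M), so the fuel never runs out.
  μ-fuel : ℕ → Subset n → Subset n → ℚ
  μ-fuel zero    X Y = 0ℚ
  μ-fuel (suc k) X Y with ≡-dec BoolP._≟_ X Y
  ... | yes _ = 1ℚ
  ... | no  _ with X ⊆? Y
  ...   | no  _ = 0ℚ
  ...   | yes _ = - sumL (λ Z → [ X ⊆? Z ] * [ Z ⊊? Y ] * μ-fuel k X Z) Λ

  μ : Subset n → Subset n → ℚ
  μ = μ-fuel (length Λ)

  λ[_,_] : (Fin n → ℚ) → Subset n → ℚ
  λ[ P , X ] = Σ[Fin] n (λ m → [ X ⊆? c m ] * P m)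

  IsProbability : (Fin n → ℚ) → Set
  IsProbability P = (∀ x → 0ℚ ≤ P x) × Σ[Fin] n P ≡ 1ℚ

  -- z generates the minimal ideal: c(z) = 0̂ is the least element of Λ(M)
  IsMinimal : Fin n → Set
  IsMinimal z = ∀ m → c z ⊆ c m

  prod : List (Fin n) → Fin n
  prod = foldr _·_ one

  -- P adapted: the submonoid generated by supp P contains an element of 0̂
  Adapted : (Fin n → ℚ) → Fin n → Set
  Adapted P z = ∃ λ (w : List (Fin n)) → All (λ x → 0ℚ < P x) w × c (prod w) ⊆ c z

  in0? : (z m : Fin n) → Dec (c m ⊆ c z)
  in0? z m = c m ⊆? c z

  -- q P z k m = Pr[ X_k = m and τ > k ]  for the right random walk started at 1
  q : (Fin n → ℚ) → Fin n → ℕ → Fin n → ℚ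
  q P z zero    m′ = [ one FinP.≟ m′ ] * [ ¬? (in0? z m′) ]
  q P z (suc k) m′ =
    Σ[Fin] n (λ m → Σ[Fin] n (λ x →
      q P z k m * P x * [ m · x FinP.≟ m′ ] * [ ¬? (in0? z m′) ]))

  Pr[τ≡_] : (Fin n → ℚ) → Fin n → ℕ → ℚ
  Pr[τ≡_] P z zero    = [ in0? z one ]
  Pr[τ≡_] P z (suc k) =
    Σ[Fin] n (λ m → Σ[Fin] n (λ x → q P z k m * P x * [ in0? z (m · x) ]))

  Eτ-partial : (Fin n → ℚ) → Fin n → ℕ → ℚ
  Eτ-partial P z zero    = 0ℚ
  Eτ-partial P z (suc N) =
    Eτ-partial P z N + (ℤ.+ N / 1) * Pr[τ≡_] P z N

  ExpectedAbsorptionTime≡ : (Fin n → ℚ) → Fin n → ℚ → Set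
  ExpectedAbsorptionTime≡ P z L =
    ∀ (ε : ℚ) → 0ℚ < ε → ∃ λ N → ∀ k → k ≥ N → ∣ Eτ-partial P z k - L ∣ ≤ ε

  RHS : (Fin n → ℚ) → Fin n → ℚ
  RHS P z = - sumL (λ X → inv (1ℚ - λ[ P , X ]) * μ (c z) X)
                   (filter (λ X → c z ⊊? X) Λ)

{-# OPTIONS --safe #-}
module Submission where

-- Let q_k be the walk killed on entering 0̂, so that Σ_m q_k(m) = Pr[τ > k].
-- Since c(m·x) = c(m) ∩ c(x), for X > 0̂ the killed walk is at time k in some m with
-- X ⊆ c(m) with probability λ_X^k, and Möbius inversion on Λ(M) writes [m ∉ 0̂] as
-- -Σ_{X > 0̂, X ⊆ c(m)} μ(0̂,X); hence Pr[τ > k] = -Σ_{X > 0̂} μ(0̂,X) λ_X^k.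
-- Summation by parts gives Σ_{k ≤ N} k Pr[τ = k] = Σ_{k < N} Pr[τ > k] - N Pr[τ > N];
-- summing the geometric series leaves the error Σ_{X > 0̂} μ(0̂,X) (1/(1-λ_X) + N) λ_X^N,
-- which is O(1/N) because adaptedness forces λ_X < 1 for every X > 0̂.

open import Defs
open import Data.Fin using (Fin)
open import Data.Rational using (ℚ)

open import Algebra.Bundles using (CommutativeRing)
import Data.Bool.Properties as Bool
open import Data.Empty using (⊥-elim)
import Data.Fin.Properties as Fin
open import Data.Fin.Subset using (Subset; _⊆_) renaming (_∈_ to _∈ₛ_)
open import Data.Fin.Subset.Properties using (_⊆?_; ⊆-antisym)
import Data.Integer as ℤ
import Data.Integer.Properties as ℤ
open import Data.List using (List; []; _∷_; _++_; _∷ʳ_; filter; length; map; allFin; upTo)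
open import Data.List.Properties using (filter-notAll; upTo-∷ʳ)
open import Data.List.Membership.Propositional using (_∈_)
open import Data.List.Membership.Propositional.Properties
  using (∈-filter⁺; ∈-filter⁻; ∈-deduplicate⁺; ∈-deduplicate⁻; ∈-map⁺; ∈-map⁻; ∈-allFin)
open import Data.List.Relation.Unary.All as All using (All; []; _∷_; all?)
open import Data.List.Relation.Unary.All.Properties using (¬All⇒Any¬)
open import Data.List.Relation.Unary.Any as Any using (here; there)
open import Data.List.Relation.Unary.Unique.Propositional using (Unique; _∷_)
open import Data.List.Relation.Unary.Unique.Propositional.Properties using (allFin⁺)
import Data.List.Relation.Unary.Unique.DecPropositional.Properties as Unique
open import Data.Nat as ℕ using (ℕ; zero; suc; _≥_; s≤s; z≤n)
import Data.Nat.Coprimality as Coprime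
import Data.Nat.Properties as ℕ
open import Data.Product using (_×_; _,_; proj₁; proj₂; ∃)
open import Data.Rational hiding (truncate; floor; ceiling; _≥_)
open import Data.Rational.Properties
open import Algebra.Properties.CommutativeSemiring.Exp (CommutativeRing.commutativeSemiring +-*-commutativeRing)
  using (_^_; ^-distrib-*)
open import Data.Sum using (inj₁; inj₂)
open import Data.Vec.Properties using (≡-dec; lookup∘tabulate; []=⇒lookup; lookup⇒[]=)
open import Function.Bundles using (Equivalence)
open import Level using (0ℓ)
open import Relation.Binary.Definitions using (DecidableEquality)
open import Relation.Binary.PropositionalEquality hiding ([_])
open import Relation.Nullary using (Dec; yes; no; ¬_; ¬?; _×-dec_)
open import Relation.Nullary.Decidable using (dec⇒maybe; toWitness; fromWitness)
open import Relation.Unary using (Pred; Decidable)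
open import Tactic.RingSolver using (solve-∀)
import Tactic.RingSolver.Core.AlmostCommutativeRing as ACR

-- The zero test lets the solver cancel coefficients that sum to zero.
ℚ-ring : ACR.AlmostCommutativeRing 0ℓ 0ℓ
ℚ-ring = ACR.fromCommutativeRing +-*-commutativeRing (λ x → dec⇒maybe (0ℚ ≟ x))

private
  variable
    A B : Set
    a b l u v w : ℚ
    f g : ℕ → ℚ

-- Indicators and finite sums

[yes] : (d : Dec A) → A → [ d ] ≡ 1ℚ
[yes] (yes _) _ = refl
[yes] (no ¬a) a = ⊥-elim (¬a a)

[no] : (d : Dec A) → ¬ A → [ d ] ≡ 0ℚ
[no] (yes a) ¬a = ⊥-elim (¬a a)
[no] (no _)  _  = refl

[]-⇔ : (d : Dec A) (e : Dec B) → (A → B) → (B → A) → [ d ] ≡ [ e ]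
[]-⇔ (yes a) e f _ = sym ([yes] e (f a))
[]-⇔ (no ¬a) e _ g = sym ([no] e (λ b → ¬a (g b)))

[¬?] : (d : Dec A) → [ ¬? d ] ≡ 1ℚ - [ d ]
[¬?] (yes _) = refl
[¬?] (no _)  = refl

[×-dec] : (d : Dec A) (e : Dec B) → [ d ×-dec e ] ≡ [ d ] * [ e ]
[×-dec] (yes _) (yes _) = refl
[×-dec] (yes _) (no _)  = refl
[×-dec] (no _)  (yes _) = refl
[×-dec] (no _)  (no _)  = refl

[]+[¬?]≡1 : (d : Dec A) → [ d ] + [ ¬? d ] ≡ 1ℚ
[]+[¬?]≡1 (yes _) = refl
[]+[¬?]≡1 (no _)  = refl

0≤[] : (d : Dec A) → 0ℚ ≤ [ d ]
0≤[] (yes _) = nonNegative⁻¹ 1ℚ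
0≤[] (no _)  = ≤-refl

*[¬?]-absorb : (d : Dec A) → (A → a ≡ 0ℚ) → a * [ ¬? d ] ≡ a
*[¬?]-absorb {a = a} (yes x) a≡0 = trans (*-zeroʳ a) (sym (a≡0 x))
*[¬?]-absorb {a = a} (no _)  _   = *-identityʳ a

*[]-guard : ∀ r (d : Dec A) → (A → a ≡ b) → r * [ d ] * a ≡ r * [ d ] * b
*[]-guard r (yes x) a≡b = cong (r * 1ℚ *_) (a≡b x)
*[]-guard {a = a} {b = b} r (no _) _ =
  trans (cong (_* a) (*-zeroʳ r)) (trans (*-zeroˡ a) (sym (trans (cong (_* b) (*-zeroʳ r)) (*-zeroˡ b))))

sumL-cong : ∀ {f g : A → ℚ} xs → (∀ {x} → x ∈ xs → f x ≡ g x) → sumL f xs ≡ sumL g xs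
sumL-cong []       _  = refl
sumL-cong (x ∷ xs) eq = cong₂ _+_ (eq (here refl)) (sumL-cong xs (λ x∈ → eq (there x∈)))

sumL-≗ : ∀ {f g : A → ℚ} xs → (∀ x → f x ≡ g x) → sumL f xs ≡ sumL g xs
sumL-≗ xs eq = sumL-cong xs (λ {x} _ → eq x)

sumL-zero : ∀ (f : A → ℚ) xs → (∀ {x} → x ∈ xs → f x ≡ 0ℚ) → sumL f xs ≡ 0ℚ
sumL-zero f []       _  = refl
sumL-zero f (x ∷ xs) eq = trans (cong₂ _+_ (eq (here refl)) (sumL-zero f xs (λ x∈ → eq (there x∈)))) (+-identityˡ 0ℚ)

sumL-+ : ∀ (f g : A → ℚ) xs → sumL (λ x → f x + g x) xs ≡ sumL f xs + sumL g xs
sumL-+ f g []       = refl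
sumL-+ f g (x ∷ xs) = trans (cong (f x + g x +_) (sumL-+ f g xs)) (interchange (f x) (g x) _ _)
  where
  interchange : ∀ a b c d → (a + b) + (c + d) ≡ (a + c) + (b + d)
  interchange = solve-∀ ℚ-ring

sumL-homo : ∀ (h : ℚ → ℚ) → h 0ℚ ≡ 0ℚ → (∀ a b → h (a + b) ≡ h a + h b) →
            ∀ (f : A → ℚ) xs → h (sumL f xs) ≡ sumL (λ x → h (f x)) xs
sumL-homo h h0 h+ f []       = h0
sumL-homo h h0 h+ f (x ∷ xs) = trans (h+ (f x) (sumL f xs)) (cong (h (f x) +_) (sumL-homo h h0 h+ f xs))

sumL-*ˡ : ∀ r (f : A → ℚ) xs → sumL (λ x → r * f x) xs ≡ r * sumL f xs
sumL-*ˡ r f xs = sym (sumL-homo (r *_) (*-zeroʳ r) (*-distribˡ-+ r) f xs)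

sumL-*ʳ : ∀ r (f : A → ℚ) xs → sumL (λ x → f x * r) xs ≡ sumL f xs * r
sumL-*ʳ r f xs = sym (sumL-homo (_* r) (*-zeroˡ r) (λ a b → *-distribʳ-+ r a b) f xs)

sumL-neg : ∀ (f : A → ℚ) xs → sumL (λ x → - f x) xs ≡ - sumL f xs
sumL-neg f xs = sym (sumL-homo -_ refl neg-distrib-+ f xs)

sumL-++ : ∀ (f : A → ℚ) xs ys → sumL f (xs ++ ys) ≡ sumL f xs + sumL f ys
sumL-++ f []       ys = sym (+-identityˡ _)
sumL-++ f (x ∷ xs) ys = trans (cong (f x +_) (sumL-++ f xs ys)) (sym (+-assoc (f x) _ _))

sumL-filter : ∀ {P : Pred A 0ℓ} (P? : Decidable P) (f : A → ℚ) xs →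
              sumL f (filter P? xs) ≡ sumL (λ x → [ P? x ] * f x) xs
sumL-filter P? f []       = refl
sumL-filter P? f (x ∷ xs) with P? x
... | yes _ = cong₂ _+_ (sym (*-identityˡ (f x))) (sumL-filter P? f xs)
... | no _  = trans (sumL-filter P? f xs) (sym (trans (cong (_+ _) (*-zeroˡ (f x))) (+-identityˡ _)))

sumL-δ : (_≟_ : DecidableEquality A) (f : A → ℚ) {y : A} {xs : List A} → Unique xs → y ∈ xs →
         sumL (λ x → [ y ≟ x ] * f x) xs ≡ f y
sumL-δ _≟_ f {y} {_ ∷ xs} (y∉ ∷ _) (here refl) = begin
  [ y ≟ y ] * f y + sumL (λ x → [ y ≟ x ] * f x) xs
    ≡⟨ cong₂ _+_ (cong (_* f y) ([yes] (y ≟ y) refl))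
                 (sumL-cong xs (λ {x} x∈ → trans (cong (_* f x) ([no] (y ≟ x) (All.lookup y∉ x∈))) (*-zeroˡ (f x)))) ⟩
  1ℚ * f y + sumL (λ _ → 0ℚ) xs
    ≡⟨ cong₂ _+_ (*-identityˡ (f y)) (sumL-zero _ xs (λ _ → refl)) ⟩
  f y + 0ℚ
    ≡⟨ +-identityʳ (f y) ⟩
  f y ∎
  where open ≡-Reasoning
sumL-δ _≟_ f {y} {x ∷ _} (x∉ ∷ u) (there y∈) =
  trans (cong₂ _+_ (cong (_* f x) ([no] (y ≟ x) (λ { refl → All.lookup x∉ y∈ refl }))) (sumL-δ _≟_ f u y∈))
        (trans (cong (_+ f y) (*-zeroˡ (f x))) (+-identityˡ (f y)))

sumL-mono-≤ : ∀ {f g : A → ℚ} xs → (∀ x → f x ≤ g x) → sumL f xs ≤ sumL g xs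
sumL-mono-≤ []       _  = ≤-refl
sumL-mono-≤ (x ∷ xs) le = +-mono-≤ (le x) (sumL-mono-≤ xs le)

sumL-nonNeg : ∀ {f : A → ℚ} xs → (∀ x → 0ℚ ≤ f x) → 0ℚ ≤ sumL f xs
sumL-nonNeg {f = f} xs 0≤f = subst (_≤ sumL f xs) (sumL-zero (λ _ → 0ℚ) xs (λ _ → refl)) (sumL-mono-≤ xs 0≤f)

sumL-≥-term : ∀ (f : A → ℚ) {y} {xs} → (∀ x → 0ℚ ≤ f x) → y ∈ xs → f y ≤ sumL f xs
sumL-≥-term f {xs = x ∷ xs} 0≤f (here refl) =
  subst (_≤ f x + sumL f xs) (+-identityʳ (f x)) (+-monoʳ-≤ (f x) (sumL-nonNeg xs 0≤f))
sumL-≥-term f {xs = x ∷ xs} 0≤f (there y∈) =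
  subst (_≤ f x + sumL f xs) (+-identityˡ _) (+-mono-≤ (0≤f x) (sumL-≥-term f 0≤f y∈))

sumL-swap : ∀ (f : A → B → ℚ) xs ys →
            sumL (λ x → sumL (f x) ys) xs ≡ sumL (λ y → sumL (λ x → f x y) xs) ys
sumL-swap f []       ys = sym (sumL-zero _ ys (λ _ → refl))
sumL-swap f (x ∷ xs) ys = trans (cong (sumL (f x) ys +_) (sumL-swap f xs ys))
                                (sym (sumL-+ (f x) (λ y → sumL (λ x → f x y) xs) ys))

-- Rational arithmetic, powers and null sequences

*-nonNeg : 0ℚ ≤ u → 0ℚ ≤ v → 0ℚ ≤ u * v
*-nonNeg {u} {v} 0≤u 0≤v = nonNegative⁻¹ _ {{nonNeg*nonNeg⇒nonNeg u {{nonNegative 0≤u}} v {{nonNegative 0≤v}}}}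

*-monoˡ-≤ : 0ℚ ≤ w → u ≤ v → w * u ≤ w * v
*-monoˡ-≤ {w} 0≤w = *-monoˡ-≤-nonNeg w {{nonNegative 0≤w}}

*-monoʳ-≤ : 0ℚ ≤ w → u ≤ v → u * w ≤ v * w
*-monoʳ-≤ {w} 0≤w = *-monoʳ-≤-nonNeg w {{nonNegative 0≤w}}

p+[q-p]≡q : ∀ p q → p + (q - p) ≡ q
p+[q-p]≡q = solve-∀ ℚ-ring

0≤q-p⇒p≤q : 0ℚ ≤ v - u → u ≤ v
0≤q-p⇒p≤q {v} {u} 0≤v-u = subst₂ _≤_ (+-identityʳ u) (p+[q-p]≡q u v) (+-monoʳ-≤ u 0≤v-u)

0<q-p⇒p<q : 0ℚ < v - u → u < v
0<q-p⇒p<q {v} {u} 0<v-u = subst₂ _<_ (+-identityʳ u) (p+[q-p]≡q u v) (+-monoʳ-< u 0<v-u)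

p<q⇒0<q-p : u < v → 0ℚ < v - u
p<q⇒0<q-p {u} {v} u<v = subst (_< v - u) (+-inverseʳ u) (+-monoˡ-< (- u) u<v)

inv-inverseˡ : u ≢ 0ℚ → inv u * u ≡ 1ℚ
inv-inverseˡ {u} u≢0 with u ≟ 0ℚ
... | yes u≡0 = ⊥-elim (u≢0 u≡0)
... | no  _   = *-inverseˡ u {{≢-nonZero u≢0}}

-- Written as in Eτ-partial, so that the two agree definitionally.
fromℕ : ℕ → ℚ
fromℕ n = ℤ.+ n / 1

fromℕ≡mkℚ : ∀ n → fromℕ n ≡ mkℚ (ℤ.+ n) 0 (Coprime.sym (Coprime.1-coprimeTo n))
fromℕ≡mkℚ n = normalize-coprime {n} (Coprime.sym (Coprime.1-coprimeTo n))

fromℕ-suc : ∀ n → fromℕ (suc n) ≡ fromℕ n + 1ℚ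
fromℕ-suc n = begin
  fromℕ (suc n)                                        ≡⟨ /-cong numerator refl ⟩
  (ℤ.+ n ℤ.* ℤ.+ 1 ℤ.+ ℤ.+ 1 ℤ.* ℤ.+ 1) / (1 ℕ.* 1)     ≡⟨ cong (_+ 1ℚ) (fromℕ≡mkℚ n) ⟨
  fromℕ n + 1ℚ                                         ∎
  where
  open ≡-Reasoning
  numerator : ℤ.+ suc n ≡ ℤ.+ n ℤ.* ℤ.+ 1 ℤ.+ ℤ.+ 1 ℤ.* ℤ.+ 1
  numerator = trans (cong ℤ.+_ (ℕ.+-comm 1 n)) (cong (ℤ._+ ℤ.+ 1) (sym (ℤ.*-identityʳ (ℤ.+ n))))

fromℕ-mono-≤ : ∀ {m n} → m ℕ.≤ n → fromℕ m ≤ fromℕ n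
fromℕ-mono-≤ {m} {n} m≤n = subst₂ _≤_ (sym (fromℕ≡mkℚ m)) (sym (fromℕ≡mkℚ n))
  (*≤* (subst₂ ℤ._≤_ (ℤ.pos-* m 1) (ℤ.pos-* n 1) (ℤ.+≤+ (ℕ.*-monoˡ-≤ 1 m≤n))))

0≤fromℕ : ∀ n → 0ℚ ≤ fromℕ n
0≤fromℕ n = fromℕ-mono-≤ {0} {n} z≤n

0<fromℕ-suc : ∀ n → 0ℚ < fromℕ (suc n)
0<fromℕ-suc n = subst (0ℚ <_) (sym (fromℕ≡mkℚ (suc n))) (positive⁻¹ _)

archimedean : ∀ r → ∃ λ n → r ≤ fromℕ n
archimedean r@(mkℚ (ℤ.+ n) d-1 _) = n , subst (r ≤_) (sym (fromℕ≡mkℚ n))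
  (*≤* (subst₂ ℤ._≤_ (ℤ.pos-* n 1) (ℤ.pos-* n (suc d-1)) (ℤ.+≤+ (ℕ.*-monoʳ-≤ n (s≤s z≤n)))))
archimedean r@(mkℚ ℤ.-[1+ _ ] _ _) = 0 , <⇒≤ (negative⁻¹ r)

0≤p*p : ∀ p → 0ℚ ≤ p * p
0≤p*p p with ≤-total 0ℚ p
... | inj₁ 0≤p = *-nonNeg 0≤p 0≤p
... | inj₂ p≤0 = nonNegative⁻¹ _ {{nonPos*nonPos⇒nonPos p {{nonPositive p≤0}} p {{nonPositive p≤0}}}}

^-nonNeg : 0ℚ ≤ l → ∀ k → 0ℚ ≤ l ^ k
^-nonNeg 0≤l zero    = nonNegative⁻¹ 1ℚ
^-nonNeg 0≤l (suc k) = *-nonNeg 0≤l (^-nonNeg 0≤l k)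

^-monoˡ-≤ : 0ℚ ≤ u → u ≤ v → ∀ k → u ^ k ≤ v ^ k
^-monoˡ-≤ _   _   zero    = ≤-refl
^-monoˡ-≤ 0≤u u≤v (suc k) = ≤-trans (*-monoʳ-≤ (^-nonNeg 0≤u k) u≤v)
                                    (*-monoˡ-≤ (≤-trans 0≤u u≤v) (^-monoˡ-≤ 0≤u u≤v k))

bernoulli : 0ℚ ≤ l → ∀ k → l ^ k * (1ℚ + fromℕ k * (1ℚ - l)) ≤ 1ℚ
bernoulli {l} 0≤l zero = ≤-reflexive (base l)
  where
  base : ∀ l → 1ℚ * (1ℚ + 0ℚ * (1ℚ - l)) ≡ 1ℚ
  base = solve-∀ ℚ-ring
bernoulli {l} 0≤l (suc k) = begin
  l * l ^ k * (1ℚ + fromℕ (suc k) * (1ℚ - l)) ≡⟨ cong (λ K → l * l ^ k * (1ℚ + K * (1ℚ - l))) (fromℕ-suc k) ⟩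
  l * l ^ k * (1ℚ + (K + 1ℚ) * (1ℚ - l))      ≡⟨ regroup l (l ^ k) K ⟩
  l ^ k * (l * (1ℚ + (K + 1ℚ) * (1ℚ - l)))    ≤⟨ *-monoˡ-≤ (^-nonNeg 0≤l k) (0≤q-p⇒p≤q 0≤gap) ⟩
  l ^ k * (1ℚ + K * (1ℚ - l))                 ≤⟨ bernoulli 0≤l k ⟩
  1ℚ                                          ∎
  where
  open ≤-Reasoning
  K = fromℕ k
  regroup : ∀ l w K → l * w * (1ℚ + (K + 1ℚ) * (1ℚ - l)) ≡ w * (l * (1ℚ + (K + 1ℚ) * (1ℚ - l)))
  regroup = solve-∀ ℚ-ring
  gap : ∀ l K → (1ℚ + K * (1ℚ - l)) - l * (1ℚ + (K + 1ℚ) * (1ℚ - l)) ≡ (K + 1ℚ) * ((1ℚ - l) * (1ℚ - l))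
  gap = solve-∀ ℚ-ring
  0≤gap : 0ℚ ≤ (1ℚ + K * (1ℚ - l)) - l * (1ℚ + (K + 1ℚ) * (1ℚ - l))
  0≤gap = subst (0ℚ ≤_) (sym (gap l K))
    (*-nonNeg (subst (0ℚ ≤_) (fromℕ-suc k) (0≤fromℕ (suc k))) (0≤p*p (1ℚ - l)))

-- ExpectedAbsorptionTime≡ M P z L unfolds to Null (λ k → Eτ-partial M P z k - L).
Null : (ℕ → ℚ) → Set
Null f = ∀ ε → 0ℚ < ε → ∃ λ N → ∀ k → k ≥ N → ∣ f k ∣ ≤ ε

Null-shift : (∀ k → f (suc k) ≡ g k) → Null g → Null f
Null-shift {f} {g} f∘suc≡g null ε 0<ε = suc N , tail
  where
  N = proj₁ (null ε 0<ε)
  tail : ∀ k → k ≥ suc N → ∣ f k ∣ ≤ ε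
  tail (suc k) (s≤s k≥N) = subst (λ x → ∣ x ∣ ≤ ε) (sym (f∘suc≡g k)) (proj₂ (null ε 0<ε) k k≥N)

O[1/n] : (ℕ → ℚ) → Set
O[1/n] f = ∃ λ C → ∀ k → ∣ f k ∣ * fromℕ k ≤ C

O[1/n]⇒Null : O[1/n] f → Null f
O[1/n]⇒Null {f} (C , bound) ε 0<ε = suc N , tail
  where
  instance
    _ = pos⇒nonZero ε {{positive 0<ε}}
  N = proj₁ (archimedean (C * 1/ ε))
  tail : ∀ k → k ≥ suc N → ∣ f k ∣ ≤ ε
  tail (suc k) (s≤s N≤k) = *-cancelʳ-≤-pos (fromℕ (suc k)) {{positive (0<fromℕ-suc k)}} (begin
    ∣ f (suc k) ∣ * fromℕ (suc k) ≤⟨ bound (suc k) ⟩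
    C                             ≡⟨ C≡C*1/ε*ε ⟩
    C * 1/ ε * ε                  ≤⟨ *-monoʳ-≤ (<⇒≤ 0<ε) (proj₂ (archimedean (C * 1/ ε))) ⟩
    fromℕ N * ε                   ≤⟨ *-monoʳ-≤ (<⇒≤ 0<ε) (fromℕ-mono-≤ (ℕ.m≤n⇒m≤1+n N≤k)) ⟩
    fromℕ (suc k) * ε             ≡⟨ *-comm (fromℕ (suc k)) ε ⟩
    ε * fromℕ (suc k)             ∎)
    where
    open ≤-Reasoning
    C≡C*1/ε*ε : C ≡ C * 1/ ε * ε
    C≡C*1/ε*ε = sym (trans (*-assoc C (1/ ε) ε) (trans (cong (C *_) (*-inverseˡ ε)) (*-identityʳ C)))

O[1/n]-+ : O[1/n] f → O[1/n] g → O[1/n] (λ k → f k + g k)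
O[1/n]-+ {f} {g} (C , f-bound) (D , g-bound) = C + D , λ k → begin
  ∣ f k + g k ∣ * fromℕ k           ≤⟨ *-monoʳ-≤ (0≤fromℕ k) (∣p+q∣≤∣p∣+∣q∣ (f k) (g k)) ⟩
  (∣ f k ∣ + ∣ g k ∣) * fromℕ k     ≡⟨ *-distribʳ-+ (fromℕ k) ∣ f k ∣ ∣ g k ∣ ⟩
  ∣ f k ∣ * fromℕ k + ∣ g k ∣ * fromℕ k ≤⟨ +-mono-≤ (f-bound k) (g-bound k) ⟩
  C + D                             ∎
  where open ≤-Reasoning

O[1/n]-*ˡ : ∀ r → O[1/n] f → O[1/n] (λ k → r * f k)
O[1/n]-*ˡ {f} r (C , bound) = ∣ r ∣ * C , λ k → begin
  ∣ r * f k ∣ * fromℕ k         ≡⟨ cong (_* fromℕ k) (∣p*q∣≡∣p∣*∣q∣ r (f k)) ⟩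
  ∣ r ∣ * ∣ f k ∣ * fromℕ k     ≡⟨ *-assoc ∣ r ∣ ∣ f k ∣ (fromℕ k) ⟩
  ∣ r ∣ * (∣ f k ∣ * fromℕ k)   ≤⟨ *-monoˡ-≤ (0≤∣p∣ r) (bound k) ⟩
  ∣ r ∣ * C                     ∎
  where open ≤-Reasoning

O[1/n]-sumL : ∀ {A : Set} (h : A → ℕ → ℚ) xs → (∀ {x} → x ∈ xs → O[1/n] (h x)) →
              O[1/n] (λ k → sumL (λ x → h x k) xs)
O[1/n]-sumL h []       _ = 0ℚ , λ k → ≤-reflexive (*-zeroˡ (fromℕ k))
O[1/n]-sumL h (x ∷ xs) O[h] = O[1/n]-+ {h x} (O[h] (here refl)) (O[1/n]-sumL h xs (λ x∈ → O[h] (there x∈)))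

O[1/n]-^ : 0ℚ ≤ l → l < 1ℚ → O[1/n] (l ^_)
O[1/n]-^ {l} 0≤l l<1 = 1/ (1ℚ - l) , bound
  where
  0<1-l : 0ℚ < 1ℚ - l
  0<1-l = p<q⇒0<q-p l<1
  instance
    _ = positive 0<1-l
    _ = pos⇒nonZero (1ℚ - l)
  bound : ∀ k → ∣ l ^ k ∣ * fromℕ k ≤ 1/ (1ℚ - l)
  bound k = *-cancelʳ-≤-pos (1ℚ - l) (begin
    ∣ l ^ k ∣ * K * (1ℚ - l)            ≡⟨ cong (λ x → x * K * (1ℚ - l)) (0≤p⇒∣p∣≡p (^-nonNeg 0≤l k)) ⟩
    l ^ k * K * (1ℚ - l)                ≡⟨ *-assoc (l ^ k) K (1ℚ - l) ⟩
    l ^ k * (K * (1ℚ - l))              ≤⟨ *-monoˡ-≤ (^-nonNeg 0≤l k) (x≤1+x (K * (1ℚ - l))) ⟩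
    l ^ k * (1ℚ + K * (1ℚ - l))         ≤⟨ bernoulli 0≤l k ⟩
    1ℚ                                  ≡⟨ *-inverseˡ (1ℚ - l) ⟨
    1/ (1ℚ - l) * (1ℚ - l)              ∎)
    where
    open ≤-Reasoning
    K = fromℕ k
    x≤1+x : ∀ x → x ≤ 1ℚ + x
    x≤1+x x = subst (_≤ 1ℚ + x) (+-identityˡ x) (+-monoˡ-≤ x (nonNegative⁻¹ 1ℚ))

-- With s = (1 + l)/2 we have l ≤ s², so k · k l^k ≤ (k s^k)², and k s^k is bounded.
O[1/n]-fromℕ*^ : 0ℚ ≤ l → l < 1ℚ → O[1/n] (λ k → fromℕ k * l ^ k)
O[1/n]-fromℕ*^ {l} 0≤l l<1 = C * C , bound
  where
  s = (1ℚ + l) * ½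
  0≤s : 0ℚ ≤ s
  0≤s = *-nonNeg (+-mono-≤ (nonNegative⁻¹ 1ℚ) 0≤l) (nonNegative⁻¹ ½)
  s<1 : s < 1ℚ
  s<1 = *-monoˡ-<-pos ½ (+-monoʳ-< 1ℚ l<1)
  l≤s*s : l ≤ s * s
  l≤s*s = 0≤q-p⇒p≤q (subst (0ℚ ≤_) (sym (gap l)) (0≤p*p ((1ℚ - l) * ½)))
    where
    gap : ∀ l → ((1ℚ + l) * ½) * ((1ℚ + l) * ½) - l ≡ ((1ℚ - l) * ½) * ((1ℚ - l) * ½)
    gap = solve-∀ ℚ-ring
  C = proj₁ (O[1/n]-^ 0≤s s<1)
  bound : ∀ k → ∣ fromℕ k * l ^ k ∣ * fromℕ k ≤ C * C
  bound k = begin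
    ∣ K * l ^ k ∣ * K              ≡⟨ cong (_* K) (0≤p⇒∣p∣≡p (*-nonNeg (0≤fromℕ k) (^-nonNeg 0≤l k))) ⟩
    K * l ^ k * K                  ≤⟨ *-monoʳ-≤ (0≤fromℕ k) (*-monoˡ-≤ (0≤fromℕ k) l^k≤s^k*s^k) ⟩
    K * (s ^ k * s ^ k) * K        ≡⟨ regroup K (s ^ k) ⟩
    (s ^ k * K) * (s ^ k * K)      ≤⟨ square-mono (*-nonNeg (^-nonNeg 0≤s k) (0≤fromℕ k)) s^k*K≤C ⟩
    C * C                          ∎
    where
    open ≤-Reasoning
    K = fromℕ k
    l^k≤s^k*s^k : l ^ k ≤ s ^ k * s ^ k
    l^k≤s^k*s^k = ≤-trans (^-monoˡ-≤ 0≤l l≤s*s k) (≤-reflexive (^-distrib-* s s k))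
    s^k*K≤C : s ^ k * K ≤ C
    s^k*K≤C = subst (λ x → x * K ≤ C) (0≤p⇒∣p∣≡p (^-nonNeg 0≤s k)) (proj₂ (O[1/n]-^ 0≤s s<1) k)
    regroup : ∀ K w → K * (w * w) * K ≡ (w * K) * (w * K)
    regroup = solve-∀ ℚ-ring
    square-mono : ∀ {x y} → 0ℚ ≤ x → x ≤ y → x * x ≤ y * y
    square-mono 0≤x x≤y = ≤-trans (*-monoˡ-≤ 0≤x x≤y) (*-monoʳ-≤ (≤-trans 0≤x x≤y) x≤y)

module _ {P Q : Pred A 0ℓ} (P? : Decidable P) (Q? : Decidable Q) (P⇒Q : ∀ {x} → P x → Q x) where

  filter-filter-⇒ : ∀ xs → filter P? (filter Q? xs) ≡ filter P? xs
  filter-filter-⇒ []       = refl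
  filter-filter-⇒ (x ∷ xs) with Q? x
  ... | yes _ with P? x
  ...   | yes _ = cong (x ∷_) (filter-filter-⇒ xs)
  ...   | no  _ = filter-filter-⇒ xs
  filter-filter-⇒ (x ∷ xs) | no ¬Qx with P? x
  ...   | yes Px = ⊥-elim (¬Qx (P⇒Q Px))
  ...   | no  _  = filter-filter-⇒ xs

  length-filter-< : ∀ xs {w} → w ∈ xs → Q w → ¬ P w → length (filter P? xs) ℕ.< length (filter Q? xs)
  length-filter-< xs w∈xs Qw ¬Pw = subst (ℕ._< length (filter Q? xs)) (cong length (filter-filter-⇒ xs))
    (filter-notAll P? (filter Q? xs) (Any.map (λ { refl → ¬Pw }) (∈-filter⁺ Q? w∈xs Qw)))

_≟ₛ_ : ∀ {n} → (X Y : Subset n) → Dec (X ≡ Y)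
_≟ₛ_ = ≡-dec Bool._≟_

module LeftRegularBand (M : FiniteLRB) where
  open FiniteLRB M

  private
    variable
      m x y : Fin n
      X Y Z : Subset n

  ∈-c⁻ : y ∈ₛ c M m → y · m ≡ y
  ∈-c⁻ {y} {m} y∈cm
    with toWitness (Equivalence.from Bool.T-≡ (trans (sym (lookup∘tabulate _ y)) ([]=⇒lookup y∈cm)))
  ... | x , refl = trans (assoc x m m) (cong (x ·_) (idem m))

  ∈-c⁺ : y · m ≡ y → y ∈ₛ c M m
  ∈-c⁺ {y} {m} y·m≡y = lookup⇒[]= y (c M m)
    (trans (lookup∘tabulate _ y) (Equivalence.to Bool.T-≡ (fromWitness (y , y·m≡y))))

  ⊆-c-one : X ⊆ c M one
  ⊆-c-one {x = y} _ = ∈-c⁺ (idʳ y)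

  ⊆-c-·⁻ˡ : X ⊆ c M (m · x) → X ⊆ c M m
  ⊆-c-·⁻ˡ {m = m} {x} X⊆cmx {y} y∈X = ∈-c⁺ (begin
    y · m                 ≡⟨ cong (_· m) (∈-c⁻ (X⊆cmx y∈X)) ⟨
    (y · (m · x)) · m     ≡⟨ assoc y (m · x) m ⟩
    y · ((m · x) · m)     ≡⟨ cong (y ·_) (lrb m x) ⟩
    y · (m · x)           ≡⟨ ∈-c⁻ (X⊆cmx y∈X) ⟩
    y                     ∎)
    where open ≡-Reasoning

  ⊆-c-·⁻ʳ : X ⊆ c M (m · x) → X ⊆ c M x
  ⊆-c-·⁻ʳ {m = m} {x} X⊆cmx {y} y∈X = ∈-c⁺ (begin
    y · x                 ≡⟨ cong (_· x) (∈-c⁻ (X⊆cmx y∈X)) ⟨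
    (y · (m · x)) · x     ≡⟨ assoc y (m · x) x ⟩
    y · ((m · x) · x)     ≡⟨ cong (y ·_) (trans (assoc m x x) (cong (m ·_) (idem x))) ⟩
    y · (m · x)           ≡⟨ ∈-c⁻ (X⊆cmx y∈X) ⟩
    y                     ∎)
    where open ≡-Reasoning

  ⊆-c-·⁺ : X ⊆ c M m → X ⊆ c M x → X ⊆ c M (m · x)
  ⊆-c-·⁺ {m = m} {x} X⊆cm X⊆cx {y} y∈X =
    ∈-c⁺ (trans (sym (assoc y m x)) (trans (cong (_· x) (∈-c⁻ (X⊆cm y∈X))) (∈-c⁻ (X⊆cx y∈X))))

  [⊆c-·] : ∀ X m x → [ X ⊆? c M (m · x) ] ≡ [ X ⊆? c M m ] * [ X ⊆? c M x ]
  [⊆c-·] X m x = trans ([]-⇔ (X ⊆? c M (m · x)) ((X ⊆? c M m) ×-dec (X ⊆? c M x))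
                           (λ h → ⊆-c-·⁻ˡ h , ⊆-c-·⁻ʳ h) (λ (h , k) → ⊆-c-·⁺ h k))
                       ([×-dec] (X ⊆? c M m) (X ⊆? c M x))

  ⊆-c-prod : ∀ {w} → All (λ x → X ⊆ c M x) w → X ⊆ c M (prod M w)
  ⊆-c-prod []             = ⊆-c-one
  ⊆-c-prod (X⊆cx ∷ X⊆cw) = ⊆-c-·⁺ X⊆cx (⊆-c-prod X⊆cw)

  c∈Λ : ∀ m → c M m ∈ Λ M
  c∈Λ m = ∈-deduplicate⁺ _≟ₛ_ (∈-map⁺ (c M) (∈-allFin m))

  ∈Λ⇒c : X ∈ Λ M → ∃ λ m → X ≡ c M m
  ∈Λ⇒c X∈Λ with ∈-map⁻ (c M) (∈-deduplicate⁻ _≟ₛ_ (map (c M) (allFin n)) X∈Λ)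
  ... | m , _ , X≡cm = m , X≡cm

  Λ-unique : Unique (Λ M)
  Λ-unique = Unique.deduplicate-! _≟ₛ_ (map (c M) (allFin n))

module MöbiusFunction (M : FiniteLRB) where
  open FiniteLRB M using (n)
  open LeftRegularBand M using (Λ-unique)

  private
    variable
      X Y Z : Subset n

  -- The recursion of μ-fuel at Y only descends to Z ⊊ Y, so height Y + 1 units of fuel suffice.
  height : Subset n → ℕ
  height Y = length (filter (λ X → _⊊?_ M X Y) (Λ M))

  height<length : Y ∈ Λ M → height Y ℕ.< length (Λ M)
  height<length {Y} Y∈Λ = filter-notAll (λ X → _⊊?_ M X Y) (Λ M) (Any.map (λ { refl (_ , Y≢Y) → Y≢Y refl }) Y∈Λ)

  ⊊-trans : _⊊_ M X Y → _⊊_ M Y Z → _⊊_ M X Z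
  ⊊-trans (X⊆Y , _) (Y⊆Z , Y≢Z) = (λ x∈X → Y⊆Z (X⊆Y x∈X)) , λ { refl → Y≢Z (⊆-antisym Y⊆Z X⊆Y) }

  height-mono-< : Z ∈ Λ M → _⊊_ M Z Y → height Z ℕ.< height Y
  height-mono-< {Z} {Y} Z∈Λ Z⊊Y =
    length-filter-< (λ X → _⊊?_ M X Z) (λ X → _⊊?_ M X Y) (λ X⊊Z → ⊊-trans X⊊Z Z⊊Y) (Λ M) Z∈Λ Z⊊Y
                    (λ (_ , Z≢Z) → Z≢Z refl)

  μ-below : ℕ → Subset n → Subset n → ℚ
  μ-below k X Y = sumL (λ Z → [ X ⊆? Z ] * [ _⊊?_ M Z Y ] * μ-fuel M k X Z) (Λ M)

  μ-fuel-stable : ∀ {k} X Y → height Y ℕ.< k → μ-fuel M k X Y ≡ μ-fuel M (suc k) X Y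
  μ-below-stable : ∀ {k} X Y → height Y ℕ.< suc k → μ-below k X Y ≡ μ-below (suc k) X Y

  μ-fuel-stable {suc k} X Y h with X ≟ₛ Y
  ... | yes _ = refl
  ... | no  _ with X ⊆? Y
  ...   | no  _ = refl
  ...   | yes _ = cong -_ (μ-below-stable X Y h)

  μ-below-stable {k} X Y h = sumL-cong (Λ M) λ {Z} Z∈Λ →
    *[]-guard [ X ⊆? Z ] (_⊊?_ M Z Y) (λ Z⊊Y → μ-fuel-stable X Z (ℕ.<-≤-trans (height-mono-< Z∈Λ Z⊊Y) (ℕ.≤-pred h)))

  μ-unfold : Y ∈ Λ M → X ≢ Y → X ⊆ Y → μ M X Y ≡ - μ-below (length (Λ M)) X Y
  μ-unfold {Y} {X} Y∈Λ = go (height<length Y∈Λ)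
    where
    go : ∀ {k} → height Y ℕ.< k → X ≢ Y → X ⊆ Y → μ-fuel M k X Y ≡ - μ-below k X Y
    go {suc k} h X≢Y X⊆Y with X ≟ₛ Y
    ... | yes X≡Y = ⊥-elim (X≢Y X≡Y)
    ... | no  _ with X ⊆? Y
    ...   | no X⊈Y = ⊥-elim (X⊈Y X⊆Y)
    ...   | yes _  = cong -_ (μ-below-stable X Y h)

  μ-refl : Y ∈ Λ M → μ M Y Y ≡ 1ℚ
  μ-refl {Y} Y∈Λ = go (ℕ.<-≤-trans (s≤s z≤n) (height<length Y∈Λ))
    where
    go : ∀ {k} → 0 ℕ.< k → μ-fuel M k Y Y ≡ 1ℚ
    go {suc k} _ with Y ≟ₛ Y
    ... | yes _   = refl
    ... | no Y≢Y = ⊥-elim (Y≢Y refl)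

  μ-interval-sum : ∀ X₀ → Y ∈ Λ M → X₀ ⊆ Y →
                   sumL (λ X → [ X₀ ⊆? X ] * [ X ⊆? Y ] * μ M X₀ X) (Λ M) ≡ [ Y ≟ₛ X₀ ]
  μ-interval-sum {Y} X₀ Y∈Λ X₀⊆Y with Y ≟ₛ X₀
  ... | yes refl = begin
    sumL (λ X → [ Y ⊆? X ] * [ X ⊆? Y ] * μ M Y X) (Λ M)
      ≡⟨ sumL-≗ (Λ M) (λ X → cong (_* μ M Y X) (antisymmetry X)) ⟩
    sumL (λ X → [ Y ≟ₛ X ] * μ M Y X) (Λ M)
      ≡⟨ sumL-δ _≟ₛ_ (μ M Y) Λ-unique Y∈Λ ⟩
    μ M Y Y
      ≡⟨ μ-refl Y∈Λ ⟩
    1ℚ ∎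
    where
    open ≡-Reasoning
    antisymmetry : ∀ X → [ Y ⊆? X ] * [ X ⊆? Y ] ≡ [ Y ≟ₛ X ]
    antisymmetry X = trans (sym ([×-dec] (Y ⊆? X) (X ⊆? Y)))
      ([]-⇔ ((Y ⊆? X) ×-dec (X ⊆? Y)) (Y ≟ₛ X) (λ (h , k) → ⊆-antisym h k) λ { refl → (λ p → p) , (λ p → p) })
  ... | no Y≢X₀ = begin
    sumL (λ X → [ X₀ ⊆? X ] * [ X ⊆? Y ] * μ M X₀ X) (Λ M)
      ≡⟨ sumL-≗ (Λ M) split ⟩
    sumL (λ X → [ X₀ ⊆? X ] * [ _⊊?_ M X Y ] * μ M X₀ X + [ Y ≟ₛ X ] * ([ X₀ ⊆? X ] * μ M X₀ X)) (Λ M)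
      ≡⟨ sumL-+ (λ X → [ X₀ ⊆? X ] * [ _⊊?_ M X Y ] * μ M X₀ X)
                (λ X → [ Y ≟ₛ X ] * ([ X₀ ⊆? X ] * μ M X₀ X)) (Λ M) ⟩
    μ-below L X₀ Y + sumL (λ X → [ Y ≟ₛ X ] * ([ X₀ ⊆? X ] * μ M X₀ X)) (Λ M)
      ≡⟨ cong (μ-below L X₀ Y +_) (sumL-δ _≟ₛ_ (λ X → [ X₀ ⊆? X ] * μ M X₀ X) Λ-unique Y∈Λ) ⟩
    μ-below L X₀ Y + [ X₀ ⊆? Y ] * μ M X₀ Y
      ≡⟨ cong (μ-below L X₀ Y +_) (trans (cong (_* μ M X₀ Y) ([yes] (X₀ ⊆? Y) X₀⊆Y)) (*-identityˡ _)) ⟩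
    μ-below L X₀ Y + μ M X₀ Y
      ≡⟨ cong (μ-below L X₀ Y +_) (μ-unfold Y∈Λ (λ X₀≡Y → Y≢X₀ (sym X₀≡Y)) X₀⊆Y) ⟩
    μ-below L X₀ Y - μ-below L X₀ Y
      ≡⟨ +-inverseʳ (μ-below L X₀ Y) ⟩
    0ℚ ∎
    where
    open ≡-Reasoning
    L = length (Λ M)
    [⊆]≡[⊊]+[≡] : ∀ X → [ X ⊆? Y ] ≡ [ _⊊?_ M X Y ] + [ Y ≟ₛ X ]
    [⊆]≡[⊊]+[≡] X with X ⊆? Y | _⊊?_ M X Y | Y ≟ₛ X
    ... | yes _   | yes _        | no _     = refl
    ... | yes _   | yes (_ , X≢Y) | yes Y≡X = ⊥-elim (X≢Y (sym Y≡X))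
    ... | yes _   | no _         | yes _    = refl
    ... | yes X⊆Y | no X⊄Y       | no Y≢X   = ⊥-elim (X⊄Y (X⊆Y , λ X≡Y → Y≢X (sym X≡Y)))
    ... | no X⊈Y  | yes (X⊆Y , _) | _       = ⊥-elim (X⊈Y X⊆Y)
    ... | no X⊈Y  | no _         | yes refl = ⊥-elim (X⊈Y (λ p → p))
    ... | no _    | no _         | no _     = refl
    split : ∀ X → [ X₀ ⊆? X ] * [ X ⊆? Y ] * μ M X₀ X
                ≡ [ X₀ ⊆? X ] * [ _⊊?_ M X Y ] * μ M X₀ X + [ Y ≟ₛ X ] * ([ X₀ ⊆? X ] * μ M X₀ X)
    split X = trans (cong (λ i → [ X₀ ⊆? X ] * i * μ M X₀ X) ([⊆]≡[⊊]+[≡] X))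
                    (distrib [ X₀ ⊆? X ] [ _⊊?_ M X Y ] [ Y ≟ₛ X ] (μ M X₀ X))
      where
      distrib : ∀ a b e m → a * (b + e) * m ≡ a * b * m + e * (a * m)
      distrib = solve-∀ ℚ-ring

sumL-upTo-suc : ∀ (f : ℕ → ℚ) N → sumL f (upTo (suc N)) ≡ sumL f (upTo N) + f N
sumL-upTo-suc f N = begin
  sumL f (upTo (suc N))              ≡⟨ cong (sumL f) (upTo-∷ʳ N) ⟨
  sumL f (upTo N ∷ʳ N)               ≡⟨ sumL-++ f (upTo N) (N ∷ []) ⟩
  sumL f (upTo N) + (f N + 0ℚ)       ≡⟨ cong (sumL f (upTo N) +_) (+-identityʳ (f N)) ⟩
  sumL f (upTo N) + f N              ∎
  where open ≡-Reasoning

geometric-sum : ∀ l N → sumL (l ^_) (upTo N) * (1ℚ - l) ≡ 1ℚ - l ^ N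
geometric-sum l zero    = *-zeroˡ (1ℚ - l)
geometric-sum l (suc N) = begin
  sumL (l ^_) (upTo (suc N)) * (1ℚ - l)     ≡⟨ cong (_* (1ℚ - l)) (sumL-upTo-suc (l ^_) N) ⟩
  (sumL (l ^_) (upTo N) + l ^ N) * (1ℚ - l)  ≡⟨ *-distribʳ-+ (1ℚ - l) (sumL (l ^_) (upTo N)) (l ^ N) ⟩
  sumL (l ^_) (upTo N) * (1ℚ - l) + l ^ N * (1ℚ - l) ≡⟨ cong (_+ l ^ N * (1ℚ - l)) (geometric-sum l N) ⟩
  1ℚ - l ^ N + l ^ N * (1ℚ - l)              ≡⟨ telescope l (l ^ N) ⟩
  1ℚ - l * l ^ N                             ∎
  where
  open ≡-Reasoning
  telescope : ∀ l w → 1ℚ - w + w * (1ℚ - l) ≡ 1ℚ - l * w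
  telescope = solve-∀ ℚ-ring

geometric-sum-closed : 1ℚ - l ≢ 0ℚ → ∀ N → sumL (l ^_) (upTo N) ≡ inv (1ℚ - l) * (1ℚ - l ^ N)
geometric-sum-closed {l} 1-l≢0 N = begin
  G                                     ≡⟨ *-identityˡ G ⟨
  1ℚ * G                                ≡⟨ cong (_* G) (inv-inverseˡ 1-l≢0) ⟨
  inv (1ℚ - l) * (1ℚ - l) * G           ≡⟨ regroup (inv (1ℚ - l)) (1ℚ - l) G ⟩
  inv (1ℚ - l) * (G * (1ℚ - l))         ≡⟨ cong (inv (1ℚ - l) *_) (geometric-sum l N) ⟩
  inv (1ℚ - l) * (1ℚ - l ^ N)           ∎
  where
  open ≡-Reasoning
  G = sumL (l ^_) (upTo N)
  regroup : ∀ i d G → i * d * G ≡ i * (G * d)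
  regroup = solve-∀ ℚ-ring

Σ-pushforward : ∀ {n} (w : Fin n → Fin n → ℚ) (f : Fin n → Fin n → Fin n) (h : Fin n → ℚ) →
  Σ[Fin] n (λ m′ → Σ[Fin] n (λ m → Σ[Fin] n (λ x → w m x * ([ f m x Fin.≟ m′ ] * h m′))))
  ≡ Σ[Fin] n (λ m → Σ[Fin] n (λ x → w m x * h (f m x)))
Σ-pushforward {n} w f h = begin
  Σ[Fin] n (λ m′ → Σ[Fin] n (λ m → Σ[Fin] n (λ x → w m x * ([ f m x Fin.≟ m′ ] * h m′))))
    ≡⟨ sumL-swap (λ m′ m → Σ[Fin] n (λ x → w m x * ([ f m x Fin.≟ m′ ] * h m′))) (allFin n) (allFin n) ⟩
  Σ[Fin] n (λ m → Σ[Fin] n (λ m′ → Σ[Fin] n (λ x → w m x * ([ f m x Fin.≟ m′ ] * h m′))))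
    ≡⟨ sumL-≗ (allFin n) (λ m → sumL-swap (λ m′ x → w m x * ([ f m x Fin.≟ m′ ] * h m′)) (allFin n) (allFin n)) ⟩
  Σ[Fin] n (λ m → Σ[Fin] n (λ x → Σ[Fin] n (λ m′ → w m x * ([ f m x Fin.≟ m′ ] * h m′))))
    ≡⟨ sumL-≗ (allFin n) (λ m → sumL-≗ (allFin n) (λ x →
         trans (sumL-*ˡ (w m x) (λ m′ → [ f m x Fin.≟ m′ ] * h m′) (allFin n))
               (cong (w m x *_) (sumL-δ Fin._≟_ h (allFin⁺ n) (∈-allFin (f m x)))))) ⟩
  Σ[Fin] n (λ m → Σ[Fin] n (λ x → w m x * h (f m x))) ∎
  where open ≡-Reasoning

module Absorption (M : FiniteLRB) (z : Fin (FiniteLRB.n M)) (minimal : IsMinimal M z) where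
  open FiniteLRB M
  open LeftRegularBand M
  open MöbiusFunction M

  private
    variable
      m : Fin n
      X : Subset n

  0̂ : Subset n
  0̂ = c M z

  Λ⁺ : List (Subset n)
  Λ⁺ = filter (λ X → _⊊?_ M 0̂ X) (Λ M)

  0̂⊆ : X ∈ Λ M → 0̂ ⊆ X
  0̂⊆ X∈Λ with ∈Λ⇒c X∈Λ
  ... | m , refl = minimal m

  ⊆c⇒unabsorbed : X ∈ Λ⁺ → X ⊆ c M m → ¬ (c M m ⊆ 0̂)
  ⊆c⇒unabsorbed X∈Λ⁺ X⊆cm cm⊆0̂ with ∈-filter⁻ (λ X → _⊊?_ M 0̂ X) {xs = Λ M} X∈Λ⁺
  ... | _ , 0̂⊆X , 0̂≢X = 0̂≢X (⊆-antisym 0̂⊆X (λ y∈X → cm⊆0̂ (X⊆cm y∈X)))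

  sumL-Λ-split : ∀ (f : Subset n → ℚ) → sumL f (Λ M) ≡ f 0̂ + sumL f Λ⁺
  sumL-Λ-split f = begin
    sumL f (Λ M)
      ≡⟨ sumL-cong (Λ M) (λ {X} X∈Λ → trans (sym (*-identityˡ (f X))) (cong (_* f X) (sym (either X∈Λ)))) ⟩
    sumL (λ X → ([ 0̂ ≟ₛ X ] + [ _⊊?_ M 0̂ X ]) * f X) (Λ M)
      ≡⟨ sumL-≗ (Λ M) (λ X → *-distribʳ-+ (f X) [ 0̂ ≟ₛ X ] [ _⊊?_ M 0̂ X ]) ⟩
    sumL (λ X → [ 0̂ ≟ₛ X ] * f X + [ _⊊?_ M 0̂ X ] * f X) (Λ M)
      ≡⟨ sumL-+ (λ X → [ 0̂ ≟ₛ X ] * f X) (λ X → [ _⊊?_ M 0̂ X ] * f X) (Λ M) ⟩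
    sumL (λ X → [ 0̂ ≟ₛ X ] * f X) (Λ M) + sumL (λ X → [ _⊊?_ M 0̂ X ] * f X) (Λ M)
      ≡⟨ cong₂ _+_ (sumL-δ _≟ₛ_ f Λ-unique (c∈Λ z)) (sym (sumL-filter (λ X → _⊊?_ M 0̂ X) f (Λ M))) ⟩
    f 0̂ + sumL f Λ⁺ ∎
    where
    open ≡-Reasoning
    either : X ∈ Λ M → [ 0̂ ≟ₛ X ] + [ _⊊?_ M 0̂ X ] ≡ 1ℚ
    either {X} X∈Λ with 0̂ ≟ₛ X | _⊊?_ M 0̂ X
    ... | yes 0̂≡X | yes (_ , 0̂≢X) = ⊥-elim (0̂≢X 0̂≡X)
    ... | yes _    | no _          = refl
    ... | no _     | yes _         = refl
    ... | no 0̂≢X  | no 0̂⊄X       = ⊥-elim (0̂⊄X (0̂⊆ X∈Λ , 0̂≢X))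

  alive : Fin n → ℚ
  alive m = [ ¬? (in0? M z m) ]

  alive≡0 : c M m ⊆ 0̂ → alive m ≡ 0ℚ
  alive≡0 {m} absorbed = [no] (¬? (in0? M z m)) (λ unabsorbed → unabsorbed absorbed)

  μ-sum-below : ∀ m → sumL (λ X → [ X ⊆? c M m ] * μ M 0̂ X) (Λ M) ≡ [ c M m ≟ₛ 0̂ ]
  μ-sum-below m = trans (sumL-cong (Λ M) 0̂⊆-factor) (μ-interval-sum 0̂ (c∈Λ m) (minimal m))
    where
    0̂⊆-factor : X ∈ Λ M → [ X ⊆? c M m ] * μ M 0̂ X ≡ [ 0̂ ⊆? X ] * [ X ⊆? c M m ] * μ M 0̂ X
    0̂⊆-factor {X} X∈Λ = cong (_* μ M 0̂ X)
      (sym (trans (cong (_* [ X ⊆? c M m ]) ([yes] (0̂ ⊆? X) (0̂⊆ X∈Λ))) (*-identityˡ [ X ⊆? c M m ])))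

  alive≡-μ-sum : ∀ m → alive m ≡ - sumL (λ X → [ X ⊆? c M m ] * μ M 0̂ X) Λ⁺
  alive≡-μ-sum m = begin
    alive m                      ≡⟨ [¬?] (in0? M z m) ⟩
    1ℚ - [ in0? M z m ]          ≡⟨ cong (λ i → 1ℚ - i) [absorbed]≡[c≡0̂] ⟩
    1ℚ - [ c M m ≟ₛ 0̂ ]          ≡⟨ cong (λ i → 1ℚ - i) (μ-sum-below m) ⟨
    1ℚ - sumL t (Λ M)            ≡⟨ cong (λ i → 1ℚ - i) (sumL-Λ-split t) ⟩
    1ℚ - (t 0̂ + sumL t Λ⁺)       ≡⟨ cong (λ i → 1ℚ - (i + sumL t Λ⁺)) t0̂≡1 ⟩
    1ℚ - (1ℚ + sumL t Λ⁺)        ≡⟨ cancel (sumL t Λ⁺) ⟩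
    - sumL t Λ⁺                  ∎
    where
    open ≡-Reasoning
    t : Subset n → ℚ
    t X = [ X ⊆? c M m ] * μ M 0̂ X
    t0̂≡1 : t 0̂ ≡ 1ℚ
    t0̂≡1 = cong₂ _*_ ([yes] (0̂ ⊆? c M m) (minimal m)) (μ-refl (c∈Λ z))
    [absorbed]≡[c≡0̂] : [ in0? M z m ] ≡ [ c M m ≟ₛ 0̂ ]
    [absorbed]≡[c≡0̂] = []-⇔ (in0? M z m) (c M m ≟ₛ 0̂) (λ cm⊆0̂ → ⊆-antisym cm⊆0̂ (minimal m))
                                                    (λ cm≡0̂ → subst (_⊆ 0̂) (sym cm≡0̂) (λ p → p))
    cancel : ∀ G → 1ℚ - (1ℚ + G) ≡ - G
    cancel = solve-∀ ℚ-ring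

module Walk (M : FiniteLRB) (z : Fin (FiniteLRB.n M)) (minimal : IsMinimal M z)
            (P : Fin (FiniteLRB.n M) → ℚ) (prob : IsProbability M P) where
  open FiniteLRB M
  open LeftRegularBand M
  open MöbiusFunction M
  open Absorption M z minimal

  private
    variable
      m : Fin n
      X : Subset n

  λ[_] : Subset n → ℚ
  λ[ X ] = λ[_,_] M P X

  survival : ℕ → ℚ
  survival k = Σ[Fin] n (q M P z k)

  q-absorbed : ∀ k → c M m ⊆ 0̂ → q M P z k m ≡ 0ℚ
  q-absorbed {m} zero absorbed =
    trans (cong ([ one Fin.≟ m ] *_) (alive≡0 absorbed)) (*-zeroʳ [ one Fin.≟ m ])
  q-absorbed {m} (suc k) absorbed =
    sumL-zero _ (allFin n) λ {m₀} _ → sumL-zero _ (allFin n) λ {x} _ →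
      trans (cong (q M P z k m₀ * P x * [ m₀ · x Fin.≟ m ] *_) (alive≡0 absorbed))
            (*-zeroʳ (q M P z k m₀ * P x * [ m₀ · x Fin.≟ m ]))

  q-alive : ∀ k m → q M P z k m * alive m ≡ q M P z k m
  q-alive k m = *[¬?]-absorb (in0? M z m) (q-absorbed k)

  alive*[⊆c] : X ∈ Λ⁺ → ∀ m → alive m * [ X ⊆? c M m ] ≡ [ X ⊆? c M m ]
  alive*[⊆c] {X} X∈Λ⁺ m = trans (*-comm (alive m) [ X ⊆? c M m ])
    (*[¬?]-absorb (in0? M z m) (λ absorbed → [no] (X ⊆? c M m) (λ X⊆cm → ⊆c⇒unabsorbed X∈Λ⁺ X⊆cm absorbed)))

  q-step : ∀ k (g : Fin n → ℚ) →
    Σ[Fin] n (λ m′ → q M P z (suc k) m′ * g m′)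
    ≡ Σ[Fin] n (λ m → Σ[Fin] n (λ x → q M P z k m * P x * (alive (m · x) * g (m · x))))
  q-step k g = begin
    Σ[Fin] n (λ m′ → q M P z (suc k) m′ * g m′)
      ≡⟨ sumL-≗ (allFin n) (λ m′ → trans (sym (sumL-*ʳ (g m′) (λ m → Σ[Fin] n (step m′ m)) (allFin n)))
                                          (sumL-≗ (allFin n) λ m →
           trans (sym (sumL-*ʳ (g m′) (step m′ m) (allFin n))) (sumL-≗ (allFin n) λ x →
             regroup (q M P z k m * P x) [ m · x Fin.≟ m′ ] (alive m′) (g m′)))) ⟩
    Σ[Fin] n (λ m′ → Σ[Fin] n (λ m → Σ[Fin] n (λ x → q M P z k m * P x * ([ m · x Fin.≟ m′ ] * (alive m′ * g m′)))))
      ≡⟨ Σ-pushforward (λ m x → q M P z k m * P x) _·_ (λ m′ → alive m′ * g m′) ⟩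
    Σ[Fin] n (λ m → Σ[Fin] n (λ x → q M P z k m * P x * (alive (m · x) * g (m · x)))) ∎
    where
    open ≡-Reasoning
    step : Fin n → Fin n → Fin n → ℚ
    step m′ m x = q M P z k m * P x * [ m · x Fin.≟ m′ ] * alive m′
    regroup : ∀ a δ v w → a * δ * v * w ≡ a * (δ * (v * w))
    regroup = solve-∀ ℚ-ring

  Σq*[⊆c]≡λ^ : X ∈ Λ⁺ → ∀ k → Σ[Fin] n (λ m → q M P z k m * [ X ⊆? c M m ]) ≡ λ[ X ] ^ k
  Σq*[⊆c]≡λ^ {X} X∈Λ⁺ zero = begin
    Σ[Fin] n (λ m → [ one Fin.≟ m ] * alive m * [ X ⊆? c M m ])
      ≡⟨ sumL-≗ (allFin n) (λ m → *-assoc [ one Fin.≟ m ] (alive m) [ X ⊆? c M m ]) ⟩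
    Σ[Fin] n (λ m → [ one Fin.≟ m ] * (alive m * [ X ⊆? c M m ]))
      ≡⟨ sumL-δ Fin._≟_ (λ m → alive m * [ X ⊆? c M m ]) (allFin⁺ n) (∈-allFin one) ⟩
    alive one * [ X ⊆? c M one ]
      ≡⟨ alive*[⊆c] X∈Λ⁺ one ⟩
    [ X ⊆? c M one ]
      ≡⟨ [yes] (X ⊆? c M one) ⊆-c-one ⟩
    1ℚ ∎
    where open ≡-Reasoning
  Σq*[⊆c]≡λ^ {X} X∈Λ⁺ (suc k) = begin
    Σ[Fin] n (λ m′ → q M P z (suc k) m′ * [ X ⊆? c M m′ ])
      ≡⟨ q-step k (λ m′ → [ X ⊆? c M m′ ]) ⟩
    Σ[Fin] n (λ m → Σ[Fin] n (λ x → q M P z k m * P x * (alive (m · x) * [ X ⊆? c M (m · x) ])))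
      ≡⟨ sumL-≗ (allFin n) (λ m → sumL-≗ (allFin n) λ x → begin
           q M P z k m * P x * (alive (m · x) * [ X ⊆? c M (m · x) ])
             ≡⟨ cong (q M P z k m * P x *_) (trans (alive*[⊆c] X∈Λ⁺ (m · x)) ([⊆c-·] X m x)) ⟩
           q M P z k m * P x * ([ X ⊆? c M m ] * [ X ⊆? c M x ])
             ≡⟨ regroup (q M P z k m) (P x) [ X ⊆? c M m ] [ X ⊆? c M x ] ⟩
           q M P z k m * [ X ⊆? c M m ] * ([ X ⊆? c M x ] * P x) ∎) ⟩
    Σ[Fin] n (λ m → Σ[Fin] n (λ x → q M P z k m * [ X ⊆? c M m ] * ([ X ⊆? c M x ] * P x)))
      ≡⟨ sumL-≗ (allFin n) (λ m → sumL-*ˡ (q M P z k m * [ X ⊆? c M m ]) (λ x → [ X ⊆? c M x ] * P x) (allFin n)) ⟩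
    Σ[Fin] n (λ m → q M P z k m * [ X ⊆? c M m ] * λ[ X ])
      ≡⟨ sumL-*ʳ λ[ X ] (λ m → q M P z k m * [ X ⊆? c M m ]) (allFin n) ⟩
    Σ[Fin] n (λ m → q M P z k m * [ X ⊆? c M m ]) * λ[ X ]
      ≡⟨ cong (_* λ[ X ]) (Σq*[⊆c]≡λ^ X∈Λ⁺ k) ⟩
    λ[ X ] ^ k * λ[ X ]
      ≡⟨ *-comm (λ[ X ] ^ k) λ[ X ] ⟩
    λ[ X ] ^ suc k ∎
    where
    open ≡-Reasoning
    regroup : ∀ a p i j → a * p * (i * j) ≡ a * i * (j * p)
    regroup = solve-∀ ℚ-ring

  survival-formula : ∀ k → survival k ≡ - sumL (λ X → λ[ X ] ^ k * μ M 0̂ X) Λ⁺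
  survival-formula k = begin
    Σ[Fin] n (q M P z k)
      ≡⟨ sumL-≗ (allFin n) (λ m → sym (q-alive k m)) ⟩
    Σ[Fin] n (λ m → q M P z k m * alive m)
      ≡⟨ sumL-≗ (allFin n) (λ m → cong (q M P z k m *_) (alive≡-μ-sum m)) ⟩
    Σ[Fin] n (λ m → q M P z k m * - sumL (λ X → [ X ⊆? c M m ] * μ M 0̂ X) Λ⁺)
      ≡⟨ sumL-≗ (allFin n) (λ m → sym (neg-distribʳ-* (q M P z k m) _)) ⟩
    Σ[Fin] n (λ m → - (q M P z k m * sumL (λ X → [ X ⊆? c M m ] * μ M 0̂ X) Λ⁺))
      ≡⟨ sumL-neg (λ m → q M P z k m * sumL (λ X → [ X ⊆? c M m ] * μ M 0̂ X) Λ⁺) (allFin n) ⟩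
    - Σ[Fin] n (λ m → q M P z k m * sumL (λ X → [ X ⊆? c M m ] * μ M 0̂ X) Λ⁺)
      ≡⟨ cong -_ (sumL-≗ (allFin n) (λ m → sym (sumL-*ˡ (q M P z k m) (λ X → [ X ⊆? c M m ] * μ M 0̂ X) Λ⁺))) ⟩
    - Σ[Fin] n (λ m → sumL (λ X → q M P z k m * ([ X ⊆? c M m ] * μ M 0̂ X)) Λ⁺)
      ≡⟨ cong -_ (sumL-swap (λ m X → q M P z k m * ([ X ⊆? c M m ] * μ M 0̂ X)) (allFin n) Λ⁺) ⟩
    - sumL (λ X → Σ[Fin] n (λ m → q M P z k m * ([ X ⊆? c M m ] * μ M 0̂ X))) Λ⁺
      ≡⟨ cong -_ (sumL-cong Λ⁺ λ {X} X∈Λ⁺ → begin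
           Σ[Fin] n (λ m → q M P z k m * ([ X ⊆? c M m ] * μ M 0̂ X))
             ≡⟨ sumL-≗ (allFin n) (λ m → sym (*-assoc (q M P z k m) [ X ⊆? c M m ] (μ M 0̂ X))) ⟩
           Σ[Fin] n (λ m → q M P z k m * [ X ⊆? c M m ] * μ M 0̂ X)
             ≡⟨ sumL-*ʳ (μ M 0̂ X) (λ m → q M P z k m * [ X ⊆? c M m ]) (allFin n) ⟩
           Σ[Fin] n (λ m → q M P z k m * [ X ⊆? c M m ]) * μ M 0̂ X
             ≡⟨ cong (_* μ M 0̂ X) (Σq*[⊆c]≡λ^ X∈Λ⁺ k) ⟩
           λ[ X ] ^ k * μ M 0̂ X ∎) ⟩
    - sumL (λ X → λ[ X ] ^ k * μ M 0̂ X) Λ⁺ ∎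
    where open ≡-Reasoning

  survival-suc : ∀ k → survival (suc k) ≡ Σ[Fin] n (λ m → Σ[Fin] n (λ x → q M P z k m * P x * alive (m · x)))
  survival-suc k = begin
    Σ[Fin] n (q M P z (suc k))
      ≡⟨ sumL-≗ (allFin n) (λ m′ → *-identityʳ (q M P z (suc k) m′)) ⟨
    Σ[Fin] n (λ m′ → q M P z (suc k) m′ * 1ℚ)
      ≡⟨ q-step k (λ _ → 1ℚ) ⟩
    Σ[Fin] n (λ m → Σ[Fin] n (λ x → q M P z k m * P x * (alive (m · x) * 1ℚ)))
      ≡⟨ sumL-≗ (allFin n) (λ m → sumL-≗ (allFin n) λ x → cong (q M P z k m * P x *_) (*-identityʳ (alive (m · x)))) ⟩
    Σ[Fin] n (λ m → Σ[Fin] n (λ x → q M P z k m * P x * alive (m · x))) ∎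
    where open ≡-Reasoning

  Pr-step : ∀ k → Pr[τ≡_] M P z (suc k) ≡ survival k - survival (suc k)
  Pr-step k = begin
    Pr                                         ≡⟨ shift Pr (survival (suc k)) ⟩
    (Pr + survival (suc k)) - survival (suc k) ≡⟨ cong (_- survival (suc k)) split ⟨
    survival k - survival (suc k)              ∎
    where
    open ≡-Reasoning
    Pr = Pr[τ≡_] M P z (suc k)
    shift : ∀ a b → a ≡ (a + b) - b
    shift = solve-∀ ℚ-ring
    weight : Fin n → Fin n → ℚ
    weight m x = q M P z k m * P x
    either : ∀ m x → weight m x ≡ weight m x * [ in0? M z (m · x) ] + weight m x * alive (m · x)
    either m x = trans (sym (trans (cong (weight m x *_) ([]+[¬?]≡1 (in0? M z (m · x)))) (*-identityʳ (weight m x))))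
                       (*-distribˡ-+ (weight m x) [ in0? M z (m · x) ] (alive (m · x)))
    split : survival k ≡ Pr + survival (suc k)
    split = begin
      Σ[Fin] n (q M P z k)
        ≡⟨ sumL-≗ (allFin n) (λ m → sym (trans (sumL-*ˡ (q M P z k m) P (allFin n))
                                               (trans (cong (q M P z k m *_) (proj₂ prob)) (*-identityʳ (q M P z k m))))) ⟩
      Σ[Fin] n (λ m → Σ[Fin] n (weight m))
        ≡⟨ sumL-≗ (allFin n) (λ m → trans (sumL-≗ (allFin n) (either m))
             (sumL-+ (λ x → weight m x * [ in0? M z (m · x) ]) (λ x → weight m x * alive (m · x)) (allFin n))) ⟩
      Σ[Fin] n (λ m → Σ[Fin] n (λ x → weight m x * [ in0? M z (m · x) ]) + Σ[Fin] n (λ x → weight m x * alive (m · x)))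
        ≡⟨ sumL-+ (λ m → Σ[Fin] n (λ x → weight m x * [ in0? M z (m · x) ]))
                  (λ m → Σ[Fin] n (λ x → weight m x * alive (m · x))) (allFin n) ⟩
      Pr + Σ[Fin] n (λ m → Σ[Fin] n (λ x → weight m x * alive (m · x)))
        ≡⟨ cong (Pr +_) (survival-suc k) ⟨
      Pr + survival (suc k) ∎

  Eτ-by-parts : ∀ N → Eτ-partial M P z (suc N) ≡ sumL survival (upTo N) - fromℕ N * survival N
  Eτ-by-parts zero = base (Pr[τ≡_] M P z 0) (survival 0)
    where
    base : ∀ a b → 0ℚ + 0ℚ * a ≡ 0ℚ - 0ℚ * b
    base = solve-∀ ℚ-ring
  Eτ-by-parts (suc N) = begin
    Eτ-partial M P z (suc N) + fromℕ (suc N) * Pr[τ≡_] M P z (suc N)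
      ≡⟨ cong₂ _+_ (Eτ-by-parts N) (cong₂ _*_ (fromℕ-suc N) (Pr-step N)) ⟩
    sumL survival (upTo N) - K * survival N + (K + 1ℚ) * (survival N - survival (suc N))
      ≡⟨ telescope (sumL survival (upTo N)) K (survival N) (survival (suc N)) ⟩
    (sumL survival (upTo N) + survival N) - (K + 1ℚ) * survival (suc N)
      ≡⟨ cong₂ (λ Σs K′ → Σs - K′ * survival (suc N)) (sumL-upTo-suc survival N) (fromℕ-suc N) ⟨
    sumL survival (upTo (suc N)) - fromℕ (suc N) * survival (suc N) ∎
    where
    open ≡-Reasoning
    K = fromℕ N
    telescope : ∀ Σs K s s′ → Σs - K * s + (K + 1ℚ) * (s - s′) ≡ (Σs + s) - (K + 1ℚ) * s′
    telescope = solve-∀ ℚ-ring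

  λ-nonNeg : ∀ X → 0ℚ ≤ λ[ X ]
  λ-nonNeg X = sumL-nonNeg (allFin n) (λ m → *-nonNeg (0≤[] (X ⊆? c M m)) (proj₁ prob m))

  1-λ≡Σ[⊈c]P : ∀ X → 1ℚ - λ[ X ] ≡ Σ[Fin] n (λ m → [ ¬? (X ⊆? c M m) ] * P m)
  1-λ≡Σ[⊈c]P X = begin
    1ℚ - λ[ X ]
      ≡⟨ cong (_- λ[ X ]) (proj₂ prob) ⟨
    Σ[Fin] n P - λ[ X ]
      ≡⟨ cong (Σ[Fin] n P +_) (sumL-neg (λ m → [ X ⊆? c M m ] * P m) (allFin n)) ⟨
    Σ[Fin] n P + Σ[Fin] n (λ m → - ([ X ⊆? c M m ] * P m))
      ≡⟨ sumL-+ P (λ m → - ([ X ⊆? c M m ] * P m)) (allFin n) ⟨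
    Σ[Fin] n (λ m → P m - [ X ⊆? c M m ] * P m)
      ≡⟨ sumL-≗ (allFin n) (λ m → trans (complement (P m) [ X ⊆? c M m ]) (cong (_* P m) (sym ([¬?] (X ⊆? c M m))))) ⟩
    Σ[Fin] n (λ m → [ ¬? (X ⊆? c M m) ] * P m) ∎
    where
    open ≡-Reasoning
    complement : ∀ p i → p - i * p ≡ (1ℚ - i) * p
    complement = solve-∀ ℚ-ring

  adapted⇒supp⊈ : Adapted M P z → X ∈ Λ⁺ → ∃ λ x → 0ℚ < P x × ¬ (X ⊆ c M x)
  adapted⇒supp⊈ {X} (w , 0<P[w] , c[w]⊆0̂) X∈Λ⁺ with all? (λ x → X ⊆? c M x) w
  ... | yes X⊆c[w] = ⊥-elim (⊆c⇒unabsorbed X∈Λ⁺ (⊆-c-prod X⊆c[w]) c[w]⊆0̂)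
  ... | no ¬X⊆c[w] = Any.lookup outside , All.lookupAny 0<P[w] outside
    where outside = ¬All⇒Any¬ (λ x → X ⊆? c M x) w ¬X⊆c[w]

  λ<1 : Adapted M P z → X ∈ Λ⁺ → λ[ X ] < 1ℚ
  λ<1 {X} adapted X∈Λ⁺ with adapted⇒supp⊈ adapted X∈Λ⁺
  ... | x , 0<Px , X⊈cx = 0<q-p⇒p<q (begin-strict
    0ℚ                                            <⟨ 0<Px ⟩
    P x                                           ≡⟨ *-identityˡ (P x) ⟨
    1ℚ * P x                                      ≡⟨ cong (_* P x) ([yes] (¬? (X ⊆? c M x)) X⊈cx) ⟨
    [ ¬? (X ⊆? c M x) ] * P x                     ≤⟨ sumL-≥-term (λ m → [ ¬? (X ⊆? c M m) ] * P m)
                                                       (λ m → *-nonNeg (0≤[] (¬? (X ⊆? c M m))) (proj₁ prob m)) (∈-allFin x) ⟩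
    Σ[Fin] n (λ m → [ ¬? (X ⊆? c M m) ] * P m)    ≡⟨ 1-λ≡Σ[⊈c]P X ⟨
    1ℚ - λ[ X ]                                   ∎)
    where open ≤-Reasoning

  error : Subset n → ℕ → ℚ
  error X N = μ M 0̂ X * (inv (1ℚ - λ[ X ]) * λ[ X ] ^ N + fromℕ N * λ[ X ] ^ N)

  O[1/n]-error : Adapted M P z → X ∈ Λ⁺ → O[1/n] (error X)
  O[1/n]-error {X} adapted X∈Λ⁺ =
    O[1/n]-*ˡ (μ M 0̂ X)
      (O[1/n]-+ {λ k → inv (1ℚ - λ[ X ]) * λ[ X ] ^ k}
        (O[1/n]-*ˡ (inv (1ℚ - λ[ X ])) (O[1/n]-^ (λ-nonNeg X) (λ<1 adapted X∈Λ⁺)))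
        (O[1/n]-fromℕ*^ (λ-nonNeg X) (λ<1 adapted X∈Λ⁺)))

  survival-partial-sum : ∀ N →
    sumL survival (upTo N) ≡ - sumL (λ X → sumL (λ k → λ[ X ] ^ k) (upTo N) * μ M 0̂ X) Λ⁺
  survival-partial-sum N = begin
    sumL survival (upTo N)
      ≡⟨ sumL-≗ (upTo N) survival-formula ⟩
    sumL (λ k → - sumL (λ X → λ[ X ] ^ k * μ M 0̂ X) Λ⁺) (upTo N)
      ≡⟨ sumL-neg (λ k → sumL (λ X → λ[ X ] ^ k * μ M 0̂ X) Λ⁺) (upTo N) ⟩
    - sumL (λ k → sumL (λ X → λ[ X ] ^ k * μ M 0̂ X) Λ⁺) (upTo N)
      ≡⟨ cong -_ (sumL-swap (λ k X → λ[ X ] ^ k * μ M 0̂ X) (upTo N) Λ⁺) ⟩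
    - sumL (λ X → sumL (λ k → λ[ X ] ^ k * μ M 0̂ X) (upTo N)) Λ⁺
      ≡⟨ cong -_ (sumL-≗ Λ⁺ (λ X → sumL-*ʳ (μ M 0̂ X) (λ[ X ] ^_) (upTo N))) ⟩
    - sumL (λ X → sumL (λ k → λ[ X ] ^ k) (upTo N) * μ M 0̂ X) Λ⁺ ∎
    where open ≡-Reasoning

  Eτ-error : (∀ {X} → X ∈ Λ⁺ → λ[ X ] < 1ℚ) →
             ∀ N → Eτ-partial M P z (suc N) - RHS M P z ≡ sumL (λ X → error X N) Λ⁺
  Eτ-error λ⁺<1 N = begin
    Eτ-partial M P z (suc N) - RHS M P z
      ≡⟨ cong (_- RHS M P z) (Eτ-by-parts N) ⟩
    sumL survival (upTo N) - K * survival N - RHS M P z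
      ≡⟨ cong₂ (λ A B → A - K * B - RHS M P z) (survival-partial-sum N) (survival-formula N) ⟩
    - sumL Gμ Λ⁺ - K * (- sumL Lμ Λ⁺) - (- sumL Aμ Λ⁺)
      ≡⟨ regroup (sumL Gμ Λ⁺) K (sumL Lμ Λ⁺) (sumL Aμ Λ⁺) ⟩
    sumL Aμ Λ⁺ + - sumL Gμ Λ⁺ + K * sumL Lμ Λ⁺
      ≡⟨ cong₂ (λ A B → sumL Aμ Λ⁺ + A + B) (sumL-neg Gμ Λ⁺) (sumL-*ˡ K Lμ Λ⁺) ⟨
    sumL Aμ Λ⁺ + sumL (λ X → - Gμ X) Λ⁺ + sumL (λ X → K * Lμ X) Λ⁺
      ≡⟨ cong (_+ sumL (λ X → K * Lμ X) Λ⁺) (sumL-+ Aμ (λ X → - Gμ X) Λ⁺) ⟨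
    sumL (λ X → Aμ X + - Gμ X) Λ⁺ + sumL (λ X → K * Lμ X) Λ⁺
      ≡⟨ sumL-+ (λ X → Aμ X + - Gμ X) (λ X → K * Lμ X) Λ⁺ ⟨
    sumL (λ X → Aμ X + - Gμ X + K * Lμ X) Λ⁺
      ≡⟨ sumL-cong Λ⁺ (λ X∈Λ⁺ → per-term (λ⁺<1 X∈Λ⁺)) ⟩
    sumL (λ X → error X N) Λ⁺ ∎
    where
    open ≡-Reasoning
    K = fromℕ N
    Gμ Lμ Aμ : Subset n → ℚ
    Gμ X = sumL (λ k → λ[ X ] ^ k) (upTo N) * μ M 0̂ X
    Lμ X = λ[ X ] ^ N * μ M 0̂ X
    Aμ X = inv (1ℚ - λ[ X ]) * μ M 0̂ X
    regroup : ∀ G K L A → - G - K * (- L) - (- A) ≡ A + - G + K * L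
    regroup = solve-∀ ℚ-ring
    per-term : ∀ {X} → λ[ X ] < 1ℚ → Aμ X + - Gμ X + K * Lμ X ≡ error X N
    per-term {X} λX<1 = trans
      (cong (λ G → Aμ X + - (G * μ M 0̂ X) + K * Lμ X)
            (geometric-sum-closed (λ 1-λ≡0 → <⇒≢ (p<q⇒0<q-p λX<1) (sym 1-λ≡0)) N))
      (collect (inv (1ℚ - λ[ X ])) (μ M 0̂ X) (λ[ X ] ^ N) K)
      where
      collect : ∀ i μ w K → i * μ + - (i * (1ℚ - w) * μ) + K * (w * μ) ≡ μ * (i * w + K * w)
      collect = solve-∀ ℚ-ring

theorem4p16 : (M : FiniteLRB) (P : Fin (FiniteLRB.n M) → ℚ) (z : Fin (FiniteLRB.n M))
    → IsMinimal M z → IsProbability M P → Adapted M P z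
    → ExpectedAbsorptionTime≡ M P z (RHS M P z)
theorem4p16 M P z minimal prob adapted =
  Null-shift (Eτ-error (λ<1 adapted)) (O[1/n]⇒Null (O[1/n]-sumL error Λ⁺ (O[1/n]-error adapted)))
  where
  open Absorption M z minimal using (Λ⁺)
  open Walk M z minimal P prob
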